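{- The functions $g_1(x,y,z,u)=(x\vee y)\wedge(z\vee u)$ and $g_2(x,y,z,u)=(x\wedge y)\vee(z\wedge u)$, as well as all functions obtained from them by negating some of the variables, are not Chow functions.
   Context: The Chow parameters of $f(x_1,\ldots,x_n)$ are $(w_1(f),\ldots,w_n(f),w(f))$, where $w(f)$ is the number of true points of $f$ and $w_i(f)$ is the number of true points with $x_i=1$. $f$ is a Chow function if no other Boolean function of the same variables has the same Chow parameters. -}

module Defs where

open import Data.Nat using (ℕ; zero; suc; _+_)
open import Data.Bool using (Bool; true; false; _∧_; _∨_; _xor_; if_then_else_)
open import Data.Fin using (Fin; zero; suc)
open import Data.Vec using (Vec; []; _∷_; lookup; zipWith)
open import Data.List using (List; _∷_; []; map; _++_)
open import Data.Nat.ListAction using (sum)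
open import Relation.Binary.PropositionalEquality using (_≡_)

BoolFun : ℕ → Set
BoolFun n = Vec Bool n → Bool

points : (n : ℕ) → List (Vec Bool n)
points zero = [] ∷ []
points (suc n) = map (false ∷_) (points n) ++ map (true ∷_) (points n)

countPts : ∀ {n} → (Vec Bool n → Bool) → ℕ
countPts {n} P = sum (map (λ x → if P x then 1 else 0) (points n))

w : ∀ {n} → BoolFun n → ℕ
w f = countPts f

wᵢ : ∀ {n} → Fin n → BoolFun n → ℕ
wᵢ i f = countPts (λ x → f x ∧ lookup x i)

IsChow : ∀ {n} → BoolFun n → Set
IsChow {n} f = (g : BoolFun n) → (∀ i → wᵢ i g ≡ wᵢ i f) → w g ≡ w f →
               ∀ x → g x ≡ f x

negateVars : ∀ {n} → Vec Bool n → Vec Bool n → Vec Bool n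
negateVars σ x = zipWith _xor_ σ x

g₁ : BoolFun 4
g₁ (x ∷ y ∷ z ∷ u ∷ []) = (x ∨ y) ∧ (z ∨ u)

g₂ : BoolFun 4
g₂ (x ∷ y ∷ z ∷ u ∷ []) = (x ∧ y) ∨ (z ∧ u)

-- Replacing the true points 1100, 0011 of g₁ by its false points 1010, 0101
-- (and the other way round for g₂) does not change the Chow parameters: both
-- pairs consist of two complementary points, so each pair contributes 2 to w
-- and exactly 1 to every wᵢ.  Negating variables permutes the cube and turns
-- wᵢ into either wᵢ or w − wᵢ, so equality of Chow parameters survives it.
module Submission where

open import Defs
open import Data.Bool using (Bool; true; false; not; _∧_; _xor_; if_then_else_)
open import Data.Bool.Properties using (not-involutive)
open import Data.Vec using (Vec; []; _∷_; lookup)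
open import Data.Vec.Properties using (lookup-zipWith)
open import Data.Fin using (Fin)
open import Data.Fin.Patterns using (0F; 1F; 2F; 3F)
open import Data.List using (List; []; _∷_; map; _++_)
open import Data.List.Properties using (map-++; map-∘; map-cong)
open import Data.Nat using (ℕ; suc; _+_)
open import Data.Nat.ListAction using (sum)
open import Data.Nat.ListAction.Properties using (sum-++)
open import Data.Nat.Properties using (+-comm; +-cancelʳ-≡; +-commutativeSemigroup)
open import Algebra.Properties.CommutativeSemigroup +-commutativeSemigroup using (interchange)
open import Data.Product using (_×_; _,_)
open import Function using (_∘_)
open import Relation.Nullary using (¬_)
open import Relation.Binary.PropositionalEquality
  using (_≡_; _≢_; _≗_; refl; sym; trans; cong; cong₂; subst; module ≡-Reasoning)
open ≡-Reasoning

countIn : {A : Set} → (A → Bool) → List A → ℕ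
countIn P xs = sum (map (λ x → if P x then 1 else 0) xs)

module _ {A : Set} where

  countIn-++ : (P : A → Bool) (xs ys : List A) →
               countIn P (xs ++ ys) ≡ countIn P xs + countIn P ys
  countIn-++ P xs ys = trans (cong sum (map-++ _ xs ys)) (sum-++ (map _ xs) (map _ ys))

  countIn-map : {B : Set} (P : A → Bool) (f : B → A) (xs : List B) →
                countIn P (map f xs) ≡ countIn (P ∘ f) xs
  countIn-map P f xs = cong sum (sym (map-∘ xs))

  countIn-cong : {P Q : A → Bool} → P ≗ Q → (xs : List A) → countIn P xs ≡ countIn Q xs
  countIn-cong P≗Q xs = cong sum (map-cong (λ x → cong (λ b → if b then 1 else 0) (P≗Q x)) xs)

  countIn-∧-partition : (P Q : A → Bool) (xs : List A) →
    countIn (λ x → P x ∧ not (Q x)) xs + countIn (λ x → P x ∧ Q x) xs ≡ countIn P xs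
  countIn-∧-partition P Q []       = refl
  countIn-∧-partition P Q (x ∷ xs) =
    trans (interchange (indicator (P x ∧ not (Q x))) _ (indicator (P x ∧ Q x)) _)
          (cong₂ _+_ (split (P x) (Q x)) (countIn-∧-partition P Q xs))
    where
    indicator : Bool → ℕ
    indicator b = if b then 1 else 0

    split : ∀ p q → indicator (p ∧ not q) + indicator (p ∧ q) ≡ indicator p
    split true  true  = refl
    split true  false = refl
    split false q     = refl

countPts-suc : ∀ {n} (P : Vec Bool (suc n) → Bool) →
  countPts P ≡ countPts (P ∘ (false ∷_)) + countPts (P ∘ (true ∷_))
countPts-suc {n} P = begin
  countIn P (map (false ∷_) (points n) ++ map (true ∷_) (points n))
    ≡⟨ countIn-++ P (map (false ∷_) (points n)) (map (true ∷_) (points n)) ⟩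
  countIn P (map (false ∷_) (points n)) + countIn P (map (true ∷_) (points n))
    ≡⟨ cong₂ _+_ (countIn-map P _ (points n)) (countIn-map P _ (points n)) ⟩
  countPts (P ∘ (false ∷_)) + countPts (P ∘ (true ∷_)) ∎

countPts-cong : ∀ {n} {P Q : Vec Bool n → Bool} → P ≗ Q → countPts P ≡ countPts Q
countPts-cong {n} P≗Q = countIn-cong P≗Q (points n)

countPts-∧-partition : ∀ {n} (P Q : Vec Bool n → Bool) →
  countPts (λ x → P x ∧ not (Q x)) + countPts (λ x → P x ∧ Q x) ≡ countPts P
countPts-∧-partition {n} P Q = countIn-∧-partition P Q (points n)

xor-cancelˡ : ∀ s b → s xor (s xor b) ≡ b
xor-cancelˡ false b = refl
xor-cancelˡ true  b = not-involutive b

negateVars-involutive : ∀ {n} (σ x : Vec Bool n) → negateVars σ (negateVars σ x) ≡ x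
negateVars-involutive []      []      = refl
negateVars-involutive (s ∷ σ) (b ∷ x) = cong₂ _∷_ (xor-cancelˡ s b) (negateVars-involutive σ x)

countPts-negateVars : ∀ {n} (σ : Vec Bool n) (P : Vec Bool n → Bool) →
  countPts (P ∘ negateVars σ) ≡ countPts P
countPts-negateVars []          P = refl
countPts-negateVars (false ∷ σ) P = begin
  countPts (P ∘ negateVars (false ∷ σ))
    ≡⟨ countPts-suc (P ∘ negateVars (false ∷ σ)) ⟩
  countPts (P ∘ (false ∷_) ∘ negateVars σ) + countPts (P ∘ (true ∷_) ∘ negateVars σ)
    ≡⟨ cong₂ _+_ (countPts-negateVars σ (P ∘ (false ∷_))) (countPts-negateVars σ (P ∘ (true ∷_))) ⟩
  countPts (P ∘ (false ∷_)) + countPts (P ∘ (true ∷_))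
    ≡⟨ countPts-suc P ⟨
  countPts P ∎
countPts-negateVars (true ∷ σ) P = begin
  countPts (P ∘ negateVars (true ∷ σ))
    ≡⟨ countPts-suc (P ∘ negateVars (true ∷ σ)) ⟩
  countPts (P ∘ (true ∷_) ∘ negateVars σ) + countPts (P ∘ (false ∷_) ∘ negateVars σ)
    ≡⟨ cong₂ _+_ (countPts-negateVars σ (P ∘ (true ∷_))) (countPts-negateVars σ (P ∘ (false ∷_))) ⟩
  countPts (P ∘ (true ∷_)) + countPts (P ∘ (false ∷_))
    ≡⟨ +-comm (countPts (P ∘ (true ∷_))) _ ⟩
  countPts (P ∘ (false ∷_)) + countPts (P ∘ (true ∷_))
    ≡⟨ countPts-suc P ⟨
  countPts P ∎

wᵢ-negateVars : ∀ {n} (σ : Vec Bool n) (i : Fin n) (f : BoolFun n) →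
  wᵢ i (f ∘ negateVars σ) ≡ countPts (λ y → f y ∧ (lookup σ i xor lookup y i))
wᵢ-negateVars σ i f = begin
  countPts (λ x → f (negateVars σ x) ∧ lookup x i)
    ≡⟨ countPts-cong (λ x → cong (f (negateVars σ x) ∧_) (lookup-negateVars x)) ⟩
  countPts ((λ y → f y ∧ (lookup σ i xor lookup y i)) ∘ negateVars σ)
    ≡⟨ countPts-negateVars σ (λ y → f y ∧ (lookup σ i xor lookup y i)) ⟩
  countPts (λ y → f y ∧ (lookup σ i xor lookup y i)) ∎
  where
  lookup-negateVars : ∀ x → lookup x i ≡ lookup σ i xor lookup (negateVars σ x) i
  lookup-negateVars x = begin
    lookup x i                                   ≡⟨ xor-cancelˡ (lookup σ i) (lookup x i) ⟨
    lookup σ i xor (lookup σ i xor lookup x i)   ≡⟨ cong (lookup σ i xor_) (lookup-zipWith _xor_ i σ x) ⟨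
    lookup σ i xor lookup (negateVars σ x) i     ∎

record SameChow {n} (f g : BoolFun n) : Set where
  constructor sameChow
  field
    wᵢ-eq : ∀ i → wᵢ i g ≡ wᵢ i f
    w-eq  : w g ≡ w f

¬IsChow-SameChow : ∀ {n} {f g : BoolFun n} → SameChow f g → ∀ x → g x ≢ f x → ¬ IsChow f
¬IsChow-SameChow (sameChow wᵢ≡ w≡) x gx≢fx isChow = gx≢fx (isChow _ wᵢ≡ w≡ x)

SameChow-∧-xor : ∀ {n} {f g : BoolFun n} → SameChow f g → ∀ s i →
  countPts (λ y → g y ∧ (s xor lookup y i)) ≡ countPts (λ y → f y ∧ (s xor lookup y i))
SameChow-∧-xor             (sameChow wᵢ≡ w≡) false i = wᵢ≡ i
SameChow-∧-xor {f = f} {g} (sameChow wᵢ≡ w≡) true i =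
  +-cancelʳ-≡ (wᵢ i f) _ _ (begin
    countPts (λ y → g y ∧ not (lookup y i)) + wᵢ i f
      ≡⟨ cong (countPts (λ y → g y ∧ not (lookup y i)) +_) (wᵢ≡ i) ⟨
    countPts (λ y → g y ∧ not (lookup y i)) + wᵢ i g
      ≡⟨ countPts-∧-partition g (λ y → lookup y i) ⟩
    w g
      ≡⟨ w≡ ⟩
    w f
      ≡⟨ countPts-∧-partition f (λ y → lookup y i) ⟨
    countPts (λ y → f y ∧ not (lookup y i)) + wᵢ i f ∎)

SameChow-negateVars : ∀ {n} (σ : Vec Bool n) {f g : BoolFun n} →
  SameChow f g → SameChow (f ∘ negateVars σ) (g ∘ negateVars σ)
SameChow-negateVars σ {f} {g} same@(sameChow _ w≡) = sameChow wᵢ≡ w≡′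
  where
  wᵢ≡ : ∀ i → wᵢ i (g ∘ negateVars σ) ≡ wᵢ i (f ∘ negateVars σ)
  wᵢ≡ i = begin
    wᵢ i (g ∘ negateVars σ)                              ≡⟨ wᵢ-negateVars σ i g ⟩
    countPts (λ y → g y ∧ (lookup σ i xor lookup y i))   ≡⟨ SameChow-∧-xor same (lookup σ i) i ⟩
    countPts (λ y → f y ∧ (lookup σ i xor lookup y i))   ≡⟨ wᵢ-negateVars σ i f ⟨
    wᵢ i (f ∘ negateVars σ)                              ∎

  w≡′ : w (g ∘ negateVars σ) ≡ w (f ∘ negateVars σ)
  w≡′ = begin
    w (g ∘ negateVars σ)   ≡⟨ countPts-negateVars σ g ⟩
    w g                    ≡⟨ w≡ ⟩
    w f                    ≡⟨ countPts-negateVars σ f ⟨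
    w (f ∘ negateVars σ)   ∎

¬IsChow-negateVars : ∀ {n} (σ : Vec Bool n) {f g : BoolFun n} →
  SameChow f g → ∀ x → g x ≢ f x → ¬ IsChow (f ∘ negateVars σ)
¬IsChow-negateVars σ {f} {g} same x gx≢fx =
  ¬IsChow-SameChow (SameChow-negateVars σ same) (negateVars σ x)
    (subst (λ y → g y ≢ f y) (sym (negateVars-involutive σ x)) gx≢fx)

g₁′ : BoolFun 4
g₁′ (true  ∷ false ∷ true  ∷ false ∷ []) = false
g₁′ (false ∷ true  ∷ false ∷ true  ∷ []) = false
g₁′ (true  ∷ true  ∷ false ∷ false ∷ []) = true
g₁′ (false ∷ false ∷ true  ∷ true  ∷ []) = true
g₁′ x = g₁ x

g₂′ : BoolFun 4
g₂′ (true  ∷ false ∷ true  ∷ false ∷ []) = true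
g₂′ (false ∷ true  ∷ false ∷ true  ∷ []) = true
g₂′ (true  ∷ true  ∷ false ∷ false ∷ []) = false
g₂′ (false ∷ false ∷ true  ∷ true  ∷ []) = false
g₂′ x = g₂ x

SameChow-g₁-g₁′ : SameChow g₁ g₁′
SameChow-g₁-g₁′ = sameChow (λ { 0F → refl ; 1F → refl ; 2F → refl ; 3F → refl }) refl

SameChow-g₂-g₂′ : SameChow g₂ g₂′
SameChow-g₂-g₂′ = sameChow (λ { 0F → refl ; 1F → refl ; 2F → refl ; 3F → refl }) refl

lemma5 : (σ : Vec Bool 4) →
    ¬ IsChow (λ x → g₁ (negateVars σ x)) × ¬ IsChow (λ x → g₂ (negateVars σ x))
lemma5 σ = ¬IsChow-negateVars σ SameChow-g₁-g₁′ x₁₀₁₀ (λ ())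
         , ¬IsChow-negateVars σ SameChow-g₂-g₂′ x₁₀₁₀ (λ ())
  where
  x₁₀₁₀ : Vec Bool 4
  x₁₀₁₀ = true ∷ false ∷ true ∷ false ∷ []
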